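{- Let $n\ge 3$ and consider an enclosed $n$-accordion with enclosing vertices $T$ and $B$. In any rectangular layout of it on the integer grid in which $T$ is above $B$ (or $T$ is below $B$) and no rectangle corresponding to an accordion vertex is left of or right of $T$ or $B$, the accordion rectangles have a bounding box of height at least $5$ and width at least $n$; moreover, if this bounding box has height exactly $5$ and width exactly $n$, then the accordion rectangles form a dissection of it (they tile it with no gaps). Symmetrically, in any rectangular layout in which $T$ is left of $B$ (or right of $B$) and no accordion rectangle is above or below $T$ or $B$, the accordion rectangles have a bounding box of height at least $n$ and width at least $5$, and if the height is exactly $n$ and the width exactly $5$, the accordion rectangles form a dissection of it.
   Context: An $n$-accordion is a graph on $3n+2$ vertices consisting of three disjoint simple paths with $n$ vertices each (first, second, third), two further vertices $x$ and $y$, an edge between $x$ and each vertex of the first and second paths, and an edge between $y$ and each vertex of the second and third paths; these $3n+2$ vertices are the accordion vertices. An enclosed $n$-accordion adds two vertices $T$ and $B$, with $T$ adjacent to each vertex of the first path and $B$ adjacent to each vertex of the third path. A (strong) rectangular layout of a graph is a set of axis-parallel rectangles with pairwise disjoint interiors, one per vertex, such that two rectangles' boundaries share a segment of positive length if and only if the corresponding vertices are adjacent; on the integer grid all corners are integral. Rectangle $r$ is above $s$ if the lowest extent of $r$ is no lower than the highest extent of $s$; below, left of, right of are defined symmetrically. -}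

module Defs where

open import Data.Nat using (ℕ; suc)
open import Data.Fin using (Fin; toℕ)
open import Data.Integer using (ℤ; _≤_; _<_; _⊓_; _⊔_; _-_; +_)
open import Data.List using (List; _∷_; []; map; allFin; _++_; foldr)
open import Data.Product using (_×_; ∃-syntax)
open import Data.Sum using (_⊎_)
open import Relation.Binary.PropositionalEquality using (_≡_; _≢_)
open import Relation.Nullary using (¬_)

data AccV (n : ℕ) : Set where
  p₁ p₂ p₃ : Fin n → AccV n
  vx vy    : AccV n

data EV (n : ℕ) : Set where
  acc    : AccV n → EV n
  vT vB  : EV n

data Edge {n : ℕ} : EV n → EV n → Set where
  path₁ : ∀ {k l} → suc (toℕ k) ≡ toℕ l → Edge (acc (p₁ k)) (acc (p₁ l))
  path₂ : ∀ {k l} → suc (toℕ k) ≡ toℕ l → Edge (acc (p₂ k)) (acc (p₂ l))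
  path₃ : ∀ {k l} → suc (toℕ k) ≡ toℕ l → Edge (acc (p₃ k)) (acc (p₃ l))
  x-p₁  : ∀ {k} → Edge (acc vx) (acc (p₁ k))
  x-p₂  : ∀ {k} → Edge (acc vx) (acc (p₂ k))
  y-p₂  : ∀ {k} → Edge (acc vy) (acc (p₂ k))
  y-p₃  : ∀ {k} → Edge (acc vy) (acc (p₃ k))
  T-p₁  : ∀ {k} → Edge vT (acc (p₁ k))
  B-p₃  : ∀ {k} → Edge vB (acc (p₃ k))

Adj : ∀ {n} → EV n → EV n → Set
Adj u v = Edge u v ⊎ Edge v u

record Rect : Set where
  field
    x₁ x₂ y₁ y₂ : ℤ
    wide : x₁ < x₂
    tall : y₁ < y₂
open Rect public

InteriorsDisjoint : Rect → Rect → Set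
InteriorsDisjoint r s =
  (x₂ r ≤ x₁ s) ⊎ (x₂ s ≤ x₁ r) ⊎ (y₂ r ≤ y₁ s) ⊎ (y₂ s ≤ y₁ r)

-- boundaries share a segment of positive length (for rectangles with
-- disjoint interiors): they abut along a vertical or horizontal side with
-- an overlap of positive length
SharesSegment : Rect → Rect → Set
SharesSegment r s =
  (((x₂ r ≡ x₁ s) ⊎ (x₂ s ≡ x₁ r)) × ((y₁ r ⊔ y₁ s) < (y₂ r ⊓ y₂ s)))
  ⊎ (((y₂ r ≡ y₁ s) ⊎ (y₂ s ≡ y₁ r)) × ((x₁ r ⊔ x₁ s) < (x₂ r ⊓ x₂ s)))

Above : Rect → Rect → Set
Above r s = y₂ s ≤ y₁ r

Below : Rect → Rect → Set
Below r s = Above s r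

LeftOf : Rect → Rect → Set
LeftOf r s = x₂ r ≤ x₁ s

RightOf : Rect → Rect → Set
RightOf r s = LeftOf s r

record Layout (n : ℕ) : Set where
  field
    R        : EV n → Rect
    disjoint : ∀ u v → u ≢ v → InteriorsDisjoint (R u) (R v)
    adj→seg  : ∀ u v → u ≢ v → Adj u v → SharesSegment (R u) (R v)
    seg→adj  : ∀ u v → u ≢ v → SharesSegment (R u) (R v) → Adj u v
open Layout public

accList : ∀ n → List (AccV n)
accList n = map p₁ (allFin n) ++ map p₂ (allFin n) ++ map p₃ (allFin n)
            ++ (vx ∷ vy ∷ [])

module _ {n : ℕ} (L : Layout n) where
  private
    coords : (Rect → ℤ) → List ℤ
    coords f = map (λ a → f (R L (acc a))) (accList n)

  bbLeft bbRight bbBottom bbTop : ℤ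
  bbLeft   = foldr _⊓_ (x₁ (R L (acc vx))) (coords x₁)
  bbRight  = foldr _⊔_ (x₂ (R L (acc vx))) (coords x₂)
  bbBottom = foldr _⊓_ (y₁ (R L (acc vx))) (coords y₁)
  bbTop    = foldr _⊔_ (y₂ (R L (acc vx))) (coords y₂)

  bbWidth bbHeight : ℤ
  bbWidth  = bbRight - bbLeft
  bbHeight = bbTop - bbBottom

  -- the accordion rectangles tile the bounding box: every unit grid cell
  -- [i,i+1]×[j,j+1] of the box lies in some accordion rectangle
  -- (interiors are already pairwise disjoint by the layout condition)
  Dissection : Set
  Dissection = ∀ (i j : ℤ) → bbLeft ≤ i → i < bbRight → bbBottom ≤ j → j < bbTop →
    ∃[ a ] (x₁ (R L (acc a)) ≤ i × i < x₂ (R L (acc a))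
           × y₁ (R L (acc a)) ≤ j × j < y₂ (R L (acc a)))

  VerticalCase : Set
  VerticalCase =
    (Above (R L vT) (R L vB) ⊎ Below (R L vT) (R L vB))
    × (∀ a → ¬ LeftOf (R L (acc a)) (R L vT) × ¬ RightOf (R L (acc a)) (R L vT)
           × ¬ LeftOf (R L (acc a)) (R L vB) × ¬ RightOf (R L (acc a)) (R L vB))

  HorizontalCase : Set
  HorizontalCase =
    (LeftOf (R L vT) (R L vB) ⊎ RightOf (R L vT) (R L vB))
    × (∀ a → ¬ Above (R L (acc a)) (R L vT) × ¬ Below (R L (acc a)) (R L vT)
           × ¬ Above (R L (acc a)) (R L vB) × ¬ Below (R L (acc a)) (R L vB))

{-# OPTIONS --safe #-}
module Submission where

-- Negating the y-axis, or swapping the axes, reduces everything to the case "T above B".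
-- There every accordion rectangle overlaps T and B horizontally, hence lies wholly above or
-- below each of them; lying above T propagates along adjacencies and the accordion is
-- connected, so all of them lie in the slab between B and T, with the p₁ touching T and the p₃
-- touching B.  The p₁ then occupy disjoint x-intervals, so the width is at least n.  Strictly
-- inside the slab, either x and y are stacked, or the three p₂ (each meeting x and y) are
-- stacked, or x and y touch at a corner that would lie in five rectangles, one too many for the
-- four unit cells around a point; either way the slab has height at least 5.  In a 5 × n box
-- every column holds a unit-width p₁, p₂ and p₃, the rows are forced to be p₃, y, p₂, x, p₁
-- from the bottom, and every cell is covered.

open import Defs

module Geometry where

  open import Data.Nat as ℕ using (ℕ; zero; suc)
  import Data.Nat.Properties as ℕ
  open import Data.Fin as Fin using (Fin; zero; suc; toℕ; fromℕ<; punchOut; combine)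
  import Data.Fin.Properties as Fin
  open import Data.Integer using (ℤ; +_; _+_; _-_; -_; _≤_; _<_; _⊔_; _⊓_; ∣_∣; +≤+; pred)
  import Data.Integer.Properties as ℤ
  open import Data.Integer.Solver using (module +-*-Solver)
  open +-*-Solver using (solve; _:+_; :-_; _:=_)
  open import Data.Product using (Σ; ∃-syntax; _×_; _,_; proj₁; proj₂; uncurry)
  open import Data.Sum using (_⊎_; inj₁; inj₂)
  open import Data.Empty using (⊥; ⊥-elim)
  open import Function.Definitions using (Injective)
  open import Relation.Nullary using (¬_; yes; no; contradiction)
  open import Relation.Binary.PropositionalEquality
    using (_≡_; _≢_; refl; sym; trans; cong; cong₂; subst)

  +-cancelʳ-≤ : ∀ {a b} c → a + c ≤ b + c → a ≤ b
  +-cancelʳ-≤ c a+c≤b+c = ℤ.≮⇒≥ (λ b<a → ℤ.<⇒≱ (ℤ.+-monoˡ-< c b<a) a+c≤b+c)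

  +-cancelˡ-< : ∀ a {b c} → a + b < a + c → b < c
  +-cancelˡ-< a a+b<a+c = ℤ.≰⇒> (λ c≤b → ℤ.<⇒≱ a+b<a+c (ℤ.+-monoʳ-≤ a c≤b))

  <⇒+1≤ : ∀ {a b} → a < b → a + + 1 ≤ b
  <⇒+1≤ {a} a<b = subst (_≤ _) (ℤ.+-comm (+ 1) a) (ℤ.i<j⇒suc[i]≤j a<b)

  +1≤⇒< : ∀ {a b} → a + + 1 ≤ b → a < b
  +1≤⇒< {a} a+1≤b = ℤ.suc[i]≤j⇒i<j (subst (_≤ _) (ℤ.+-comm a (+ 1)) a+1≤b)

  ≤⇒<+1 : ∀ {a b} → a ≤ b → a < b + + 1
  ≤⇒<+1 a≤b = +1≤⇒< (ℤ.+-monoˡ-≤ (+ 1) a≤b)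

  <+1⇒≤ : ∀ {a b} → a < b + + 1 → a ≤ b
  <+1⇒≤ a<b+1 = +-cancelʳ-≤ (+ 1) (<⇒+1≤ a<b+1)

  next-step : ∀ {a b c k} → a ≡ b + + k → c ≡ b + + (k ℕ.+ 1) → c ≡ a + + 1
  next-step {b = b} {k = k} a≡ c≡ =
    trans c≡ (trans (sym (ℤ.+-assoc b (+ k) (+ 1))) (cong (_+ + 1) (sym a≡)))

  a+[b-a]≡b : ∀ a b → a + (b - a) ≡ b
  a+[b-a]≡b = solve 2 (λ a b → a :+ (b :+ (:- a)) := b) refl

  [a+k]-a≡k : ∀ a k → (a + k) - a ≡ k
  [a+k]-a≡k = solve 2 (λ a k → (a :+ k) :+ (:- a) := k) refl

  b-a≡k⇒b≡a+k : ∀ {a b k} → b - a ≡ k → b ≡ a + k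
  b-a≡k⇒b≡a+k {a} {b} b-a≡k = trans (sym (a+[b-a]≡b a b)) (cong (λ d → a + d) b-a≡k)

  -- A record rather than a synonym, so that a, k and b are inferable.
  infix 4 _+[_]≤_
  record _+[_]≤_ (a : ℤ) (k : ℕ) (b : ℤ) : Set where
    constructor room
    field room≤ : a + + k ≤ b

  <⇒+[1]≤ : ∀ {a b} → a < b → a +[ 1 ]≤ b
  <⇒+[1]≤ a<b = room (<⇒+1≤ a<b)

  ≤⇒+[0]≤ : ∀ {a b} → a ≤ b → a +[ 0 ]≤ b
  ≤⇒+[0]≤ {a} a≤b = room (subst (_≤ _) (sym (ℤ.+-identityʳ a)) a≤b)

  infixr 5 _⨾_
  _⨾_ : ∀ {a b c k m} → a +[ k ]≤ b → b +[ m ]≤ c → a +[ k ℕ.+ m ]≤ c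
  _⨾_ {a} {k = k} {m} (room a+k≤b) (room b+m≤c) =
    room (subst (_≤ _) (ℤ.+-assoc a (+ k) (+ m)) (ℤ.≤-trans (ℤ.+-monoˡ-≤ (+ m) a+k≤b) b+m≤c))

  +[]≤⇒≤- : ∀ {a b k} → a +[ k ]≤ b → + k ≤ b - a
  +[]≤⇒≤- {a} {b} {k} (room a+k≤b) = subst (_≤ b - a) ([a+k]-a≡k a (+ k)) (ℤ.+-monoˡ-≤ (- a) a+k≤b)

  squeeze : ∀ {a b c k m} → a +[ k ]≤ b → b +[ m ]≤ c → c ≤ a + + (k ℕ.+ m) → b ≡ a + + k
  squeeze {a} {b} {k = k} {m} (room a+k≤b) (room b+m≤c) c≤ = ℤ.≤-antisym b≤a+k a+k≤b
    where
      b≤a+k : b ≤ a + + k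
      b≤a+k = +-cancelʳ-≤ (+ m) (ℤ.≤-trans b+m≤c (subst (_ ≤_) (sym (ℤ.+-assoc a (+ k) (+ m))) c≤))

  five-unit-steps : ∀ {a₀ a₁ a₂ a₃ a₄ a₅} →
    a₀ < a₁ → a₁ < a₂ → a₂ < a₃ → a₃ < a₄ → a₄ < a₅ → a₅ ≤ a₀ + + 5 →
    a₁ ≡ a₀ + + 1 × a₂ ≡ a₀ + + 2 × a₃ ≡ a₀ + + 3 × a₄ ≡ a₀ + + 4
  five-unit-steps {a₀} {a₁} {a₂} {a₃} {a₄} {a₅} s₁ s₂ s₃ s₄ s₅ end =
    squeeze g₁ (g₂ ⨾ g₃ ⨾ g₄ ⨾ g₅) end ,
    squeeze (g₁ ⨾ g₂) (g₃ ⨾ g₄ ⨾ g₅) end ,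
    squeeze (g₁ ⨾ g₂ ⨾ g₃) (g₄ ⨾ g₅) end ,
    squeeze (g₁ ⨾ g₂ ⨾ g₃ ⨾ g₄) g₅ end
    where
      g₁ : a₀ +[ 1 ]≤ a₁
      g₁ = <⇒+[1]≤ s₁
      g₂ : a₁ +[ 1 ]≤ a₂
      g₂ = <⇒+[1]≤ s₂
      g₃ : a₂ +[ 1 ]≤ a₃
      g₃ = <⇒+[1]≤ s₃
      g₄ : a₃ +[ 1 ]≤ a₄
      g₄ = <⇒+[1]≤ s₄
      g₅ : a₄ +[ 1 ]≤ a₅
      g₅ = <⇒+[1]≤ s₅

  a+∣b-a∣≡b : ∀ {a b} → a ≤ b → a + + ∣ b - a ∣ ≡ b
  a+∣b-a∣≡b {a} {b} a≤b =
    trans (cong (λ d → a + d) (ℤ.0≤i⇒+∣i∣≡i (ℤ.i≤j⇒0≤j-i a≤b))) (a+[b-a]≡b a b)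

  window-index : ∀ {a j W} → a ≤ j → j < a + + W → Σ (Fin W) (λ i → a + + toℕ i ≡ j)
  window-index {a} {j} {W} a≤j j<a+W =
    fromℕ< offset<W , trans (cong (λ m → a + + m) (Fin.toℕ-fromℕ< offset<W)) (a+∣b-a∣≡b a≤j)
    where
      offset<W : ∣ j - a ∣ ℕ.< W
      offset<W = ℤ.drop‿+<+ (+-cancelˡ-< a (subst (_< _) (sym (a+∣b-a∣≡b a≤j)) j<a+W))

  missed⇒≤ : ∀ {m n} {f : Fin m → Fin (suc n)} → Injective _≡_ _≡_ f →
             ∀ c → (∀ i → c ≢ f i) → m ℕ.≤ n
  missed⇒≤ f-injective c missed = Fin.injective⇒≤ {f = λ i → punchOut (missed i)}
    (λ eq → f-injective (Fin.punchOut-injective (missed _) (missed _) eq))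

  injective⇒surjective : ∀ {m n} {f : Fin m → Fin n} → Injective _≡_ _≡_ f → n ℕ.≤ m →
                         ∀ c → ∃[ i ] f i ≡ c
  injective⇒surjective {n = suc _} {f} f-injective n≤m c with Fin.any? (λ i → f i Fin.≟ c)
  ... | yes hit = hit
  ... | no miss = contradiction
    (ℕ.≤-trans n≤m (missed⇒≤ f-injective c (λ i c≡fi → miss (i , sym c≡fi)))) ℕ.1+n≰n

  module DisjointIntervals {n} (lo hi : Fin n → ℤ) (lo<hi : ∀ k → lo k < hi k)
    (separated : ∀ {k l} → k ≢ l → hi k ≤ lo l ⊎ hi l ≤ lo k)
    {a b : ℤ} (a≤b : a ≤ b) (a≤lo : ∀ k → a ≤ lo k) (hi≤b : ∀ k → hi k ≤ b) where

    lo-injective : Injective _≡_ _≡_ lo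
    lo-injective {k} {l} lo≡ with k Fin.≟ l
    ... | yes k≡l = k≡l
    ... | no k≢l with separated k≢l
    ...   | inj₁ hk≤ll = contradiction (subst (hi k ≤_) (sym lo≡) hk≤ll) (ℤ.<⇒≱ (lo<hi k))
    ...   | inj₂ hl≤lk = contradiction (subst (hi l ≤_) lo≡ hl≤lk) (ℤ.<⇒≱ (lo<hi l))

    private
      W : ℕ
      W = ∣ b - a ∣

      window : ∀ k → Σ (Fin W) (λ i → a + + toℕ i ≡ lo k)
      window k = window-index (a≤lo k)
        (subst (lo k <_) (sym (a+∣b-a∣≡b a≤b)) (ℤ.<-≤-trans (lo<hi k) (hi≤b k)))

      slot : Fin n → Fin W
      slot k = proj₁ (window k)

      slot-lo : ∀ k → a + + toℕ (slot k) ≡ lo k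
      slot-lo k = proj₂ (window k)

      slot-injective : Injective _≡_ _≡_ slot
      slot-injective {k} {l} eq = lo-injective
        (trans (sym (slot-lo k)) (trans (cong (λ i → a + + toℕ i) eq) (slot-lo l)))

    count : + n ≤ b - a
    count = subst (+ n ≤_) (ℤ.0≤i⇒+∣i∣≡i (ℤ.i≤j⇒0≤j-i a≤b)) (+≤+ (Fin.injective⇒≤ slot-injective))

    module _ (b-a≡n : b - a ≡ + n) where

      lo-onto : ∀ c → a ≤ c → c < b → ∃[ k ] lo k ≡ c
      lo-onto c a≤c c<b =
        let i , a+i≡c = window-index a≤c (subst (c <_) (sym (a+∣b-a∣≡b a≤b)) c<b)
            k , slot≡i = injective⇒surjective slot-injective (ℕ.≤-reflexive (cong ∣_∣ b-a≡n)) i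
        in k , trans (sym (slot-lo k)) (trans (cong (λ i → a + + toℕ i) slot≡i) a+i≡c)

      -- A longer interval would contain the start lo k + 1 of another one.
      unit-length : ∀ k → ¬ (lo k + + 1 < hi k)
      unit-length k lo+1<hi = next-start
        (lo-onto (lo k + + 1) (ℤ.≤-trans (a≤lo k) (ℤ.<⇒≤ lo<lo+1)) (ℤ.<-≤-trans lo+1<hi (hi≤b k)))
        where
          lo<lo+1 : lo k < lo k + + 1
          lo<lo+1 = ≤⇒<+1 ℤ.≤-refl

          next-start : ∃[ l ] lo l ≡ lo k + + 1 → ⊥
          next-start (l , lo-l≡) with separated {k} {l} (λ { refl → ℤ.<-irrefl lo-l≡ lo<lo+1 })
          ... | inj₁ hk≤ll = ℤ.<⇒≱ lo+1<hi (subst (hi k ≤_) lo-l≡ hk≤ll)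
          ... | inj₂ hl≤lk =
            ℤ.<⇒≱ (lo<hi l) (ℤ.≤-trans hl≤lk (subst (lo k ≤_) (sym lo-l≡) (ℤ.<⇒≤ lo<lo+1)))

      tile : ∀ c → a ≤ c → c < b → ∃[ k ] lo k ≡ c × hi k ≡ c + + 1
      tile c a≤c c<b =
        let k , lo≡c = lo-onto c a≤c c<b
        in k , lo≡c , subst (λ c → hi k ≡ c + + 1) lo≡c
                        (ℤ.≤-antisym (ℤ.≮⇒≥ (unit-length k)) (<⇒+1≤ (lo<hi k)))

  record OverlapX (r s : Rect) : Set where
    constructor overlapX
    field
      x₁r<x₂s : x₁ r < x₂ s
      x₁s<x₂r : x₁ s < x₂ r

  record OverlapY (r s : Rect) : Set where
    constructor overlapY
    field
      y₁r<y₂s : y₁ r < y₂ s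
      y₁s<y₂r : y₁ s < y₂ r

  ⊔<⊓⇒< : ∀ {a b c d} → a ⊔ b < c ⊓ d → a < d × b < c
  ⊔<⊓⇒< {a} {b} {c} {d} ⊔<⊓ = bound (ℤ.i≤i⊔j a b) (ℤ.i⊓j≤j c d) , bound (ℤ.i≤j⊔i a b) (ℤ.i⊓j≤i c d)
    where
      bound : ∀ {x y} → x ≤ a ⊔ b → c ⊓ d ≤ y → x < y
      bound x≤ ≤y = ℤ.≤-<-trans x≤ (ℤ.<-≤-trans ⊔<⊓ ≤y)

  <⇒⊔<⊓ : ∀ {a b c d} → a < c → a < d → b < c → b < d → a ⊔ b < c ⊓ d
  <⇒⊔<⊓ {a} {b} {c} {d} a<c a<d b<c b<d with ℤ.⊔-sel a b | ℤ.⊓-sel c d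
  ... | inj₁ ⊔≡a | inj₁ ⊓≡c rewrite ⊔≡a | ⊓≡c = a<c
  ... | inj₁ ⊔≡a | inj₂ ⊓≡d rewrite ⊔≡a | ⊓≡d = a<d
  ... | inj₂ ⊔≡b | inj₁ ⊓≡c rewrite ⊔≡b | ⊓≡c = b<c
  ... | inj₂ ⊔≡b | inj₂ ⊓≡d rewrite ⊔≡b | ⊓≡d = b<d

  shares⇒overlap : ∀ {r s} → SharesSegment r s → OverlapY r s ⊎ OverlapX r s
  shares⇒overlap (inj₁ (_ , ⊔<⊓)) = inj₁ (uncurry overlapY (⊔<⊓⇒< ⊔<⊓))
  shares⇒overlap (inj₂ (_ , ⊔<⊓)) = inj₂ (uncurry overlapX (⊔<⊓⇒< ⊔<⊓))

  touchY⇒shares : ∀ {r s} → OverlapX r s → y₂ r ≡ y₁ s ⊎ y₂ s ≡ y₁ r → SharesSegment r s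
  touchY⇒shares {r} {s} (overlapX r<s s<r) touch = inj₂ (touch , <⇒⊔<⊓ (wide r) r<s s<r (wide s))

  separatedY : ∀ {r s} → InteriorsDisjoint r s → OverlapX r s → y₂ r ≤ y₁ s ⊎ y₂ s ≤ y₁ r
  separatedY (inj₁ x₂r≤x₁s) (overlapX _ x₁s<x₂r) = contradiction x₂r≤x₁s (ℤ.<⇒≱ x₁s<x₂r)
  separatedY (inj₂ (inj₁ x₂s≤x₁r)) (overlapX x₁r<x₂s _) = contradiction x₂s≤x₁r (ℤ.<⇒≱ x₁r<x₂s)
  separatedY (inj₂ (inj₂ y-separated)) _ = y-separated

  separatedX : ∀ {r s} → InteriorsDisjoint r s → OverlapY r s → x₂ r ≤ x₁ s ⊎ x₂ s ≤ x₁ r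
  separatedX (inj₁ x₂r≤x₁s) _ = inj₁ x₂r≤x₁s
  separatedX (inj₂ (inj₁ x₂s≤x₁r)) _ = inj₂ x₂s≤x₁r
  separatedX (inj₂ (inj₂ (inj₁ y₂r≤y₁s))) (overlapY _ y₁s<y₂r) = contradiction y₂r≤y₁s (ℤ.<⇒≱ y₁s<y₂r)
  separatedX (inj₂ (inj₂ (inj₂ y₂s≤y₁r))) (overlapY y₁r<y₂s _) = contradiction y₂s≤y₁r (ℤ.<⇒≱ y₁r<y₂s)

  shares-below⇒touch : ∀ {r t} → SharesSegment r t → y₂ r ≤ y₁ t → y₂ r ≡ y₁ t
  shares-below⇒touch (inj₁ (_ , ⊔<⊓)) y₂r≤y₁t = contradiction y₂r≤y₁t (ℤ.<⇒≱ (proj₂ (⊔<⊓⇒< ⊔<⊓)))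
  shares-below⇒touch (inj₂ (inj₁ y₂r≡y₁t , _)) _ = y₂r≡y₁t
  shares-below⇒touch {r} {t} (inj₂ (inj₂ y₂t≡y₁r , _)) y₂r≤y₁t = contradiction
    (ℤ.<-trans (tall r) (ℤ.≤-<-trans y₂r≤y₁t (ℤ.<-≤-trans (tall t) (ℤ.≤-reflexive y₂t≡y₁r))))
    (ℤ.<-irrefl refl)

  record Meets (r s : Rect) : Set where
    field
      x₁r≤x₂s : x₁ r ≤ x₂ s
      x₁s≤x₂r : x₁ s ≤ x₂ r
      y₁r≤y₂s : y₁ r ≤ y₂ s
      y₁s≤y₂r : y₁ s ≤ y₂ r
  open Meets public

  meets-refl : ∀ r → Meets r r
  meets-refl r = record
    { x₁r≤x₂s = ℤ.<⇒≤ (wide r) ; x₁s≤x₂r = ℤ.<⇒≤ (wide r)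
    ; y₁r≤y₂s = ℤ.<⇒≤ (tall r) ; y₁s≤y₂r = ℤ.<⇒≤ (tall r) }

  meets-sym : ∀ {r s} → Meets r s → Meets s r
  meets-sym m = record
    { x₁r≤x₂s = x₁s≤x₂r m ; x₁s≤x₂r = x₁r≤x₂s m ; y₁r≤y₂s = y₁s≤y₂r m ; y₁s≤y₂r = y₁r≤y₂s m }

  Touch : ℤ → ℤ → ℤ → ℤ → Set
  Touch a₁ a₂ b₁ b₂ = a₂ ≡ b₁ ⊎ b₂ ≡ a₁

  touch⇒meet : ∀ {a₁ a₂ b₁ b₂} → a₁ < a₂ → b₁ < b₂ → Touch a₁ a₂ b₁ b₂ → a₁ ≤ b₂ × b₁ ≤ a₂
  touch⇒meet a₁<a₂ b₁<b₂ (inj₁ refl) = ℤ.<⇒≤ (ℤ.<-trans a₁<a₂ b₁<b₂) , ℤ.≤-refl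
  touch⇒meet a₁<a₂ b₁<b₂ (inj₂ refl) = ℤ.≤-refl , ℤ.<⇒≤ (ℤ.<-trans b₁<b₂ a₁<a₂)

  shares⇒meets : ∀ {r s} → SharesSegment r s → Meets r s
  shares⇒meets {r} {s} (inj₁ (touch , ⊔<⊓)) = record
    { x₁r≤x₂s = proj₁ (touch⇒meet (wide r) (wide s) touch)
    ; x₁s≤x₂r = proj₂ (touch⇒meet (wide r) (wide s) touch)
    ; y₁r≤y₂s = ℤ.<⇒≤ (proj₁ (⊔<⊓⇒< ⊔<⊓)) ; y₁s≤y₂r = ℤ.<⇒≤ (proj₂ (⊔<⊓⇒< ⊔<⊓)) }
  shares⇒meets {r} {s} (inj₂ (touch , ⊔<⊓)) = record
    { x₁r≤x₂s = ℤ.<⇒≤ (proj₁ (⊔<⊓⇒< ⊔<⊓)) ; x₁s≤x₂r = ℤ.<⇒≤ (proj₂ (⊔<⊓⇒< ⊔<⊓))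
    ; y₁r≤y₂s = proj₁ (touch⇒meet (tall r) (tall s) touch)
    ; y₁s≤y₂r = proj₂ (touch⇒meet (tall r) (tall s) touch) }

  meet-without-overlap⇒touch : ∀ {a₁ a₂ b₁ b₂} → a₁ < a₂ → b₁ < b₂ → a₁ ≤ b₂ → b₁ ≤ a₂ →
                               ¬ (a₁ ⊔ b₁ < a₂ ⊓ b₂) → Touch a₁ a₂ b₁ b₂
  meet-without-overlap⇒touch {a₁} {a₂} {b₁} {b₂} a₁<a₂ b₁<b₂ a₁≤b₂ b₁≤a₂ ¬overlap
    with a₂ ℤ.≤? b₁ | b₂ ℤ.≤? a₁
  ... | yes a₂≤b₁ | _ = inj₁ (ℤ.≤-antisym a₂≤b₁ b₁≤a₂)
  ... | no _ | yes b₂≤a₁ = inj₂ (ℤ.≤-antisym b₂≤a₁ a₁≤b₂)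
  ... | no a₂≰b₁ | no b₂≰a₁ = contradiction (<⇒⊔<⊓ a₁<a₂ (ℤ.≰⇒> b₂≰a₁) (ℤ.≰⇒> a₂≰b₁) b₁<b₂) ¬overlap

  TouchX TouchY : Rect → Rect → Set
  TouchX r s = Touch (x₁ r) (x₂ r) (x₁ s) (x₂ s)
  TouchY r s = Touch (y₁ r) (y₂ r) (y₁ s) (y₂ s)

  separated+meet⇒touch : ∀ {a₁ a₂ b₁ b₂} → a₂ ≤ b₁ ⊎ b₂ ≤ a₁ → a₁ ≤ b₂ → b₁ ≤ a₂ → Touch a₁ a₂ b₁ b₂
  separated+meet⇒touch (inj₁ a₂≤b₁) _ b₁≤a₂ = inj₁ (ℤ.≤-antisym a₂≤b₁ b₁≤a₂)
  separated+meet⇒touch (inj₂ b₂≤a₁) a₁≤b₂ _ = inj₂ (ℤ.≤-antisym b₂≤a₁ a₁≤b₂)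

  module _ {r s} (m : Meets r s) (¬shares : ¬ SharesSegment r s) where

    touchX⇒touchY : TouchX r s → TouchY r s
    touchX⇒touchY tx = meet-without-overlap⇒touch (tall r) (tall s) (y₁r≤y₂s m) (y₁s≤y₂r m)
      (λ ⊔<⊓ → ¬shares (inj₁ (tx , ⊔<⊓)))

    touchY⇒touchX : TouchY r s → TouchX r s
    touchY⇒touchX ty = meet-without-overlap⇒touch (wide r) (wide s) (x₁r≤x₂s m) (x₁s≤x₂r m)
      (λ ⊔<⊓ → ¬shares (inj₂ (ty , ⊔<⊓)))

    corner : InteriorsDisjoint r s → TouchX r s × TouchY r s
    corner (inj₁ x₂r≤x₁s) = tx , touchX⇒touchY tx
      where
        tx : TouchX r s
        tx = separated+meet⇒touch (inj₁ x₂r≤x₁s) (x₁r≤x₂s m) (x₁s≤x₂r m)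
    corner (inj₂ (inj₁ x₂s≤x₁r)) = tx , touchX⇒touchY tx
      where
        tx : TouchX r s
        tx = separated+meet⇒touch (inj₂ x₂s≤x₁r) (x₁r≤x₂s m) (x₁s≤x₂r m)
    corner (inj₂ (inj₂ y-separated)) = touchY⇒touchX ty , ty
      where
        ty : TouchY r s
        ty = separated+meet⇒touch y-separated (y₁r≤y₂s m) (y₁s≤y₂r m)

  touchPoint : ∀ {a₁ a₂ b₁ b₂} → Touch a₁ a₂ b₁ b₂ → ℤ
  touchPoint {a₂ = a₂} (inj₁ _) = a₂
  touchPoint {a₁ = a₁} (inj₂ _) = a₁

  touchPoint-between : ∀ {a₁ a₂ b₁ b₂ p₁ p₂} → p₁ ≤ a₂ → b₁ ≤ p₂ → p₁ ≤ b₂ → a₁ ≤ p₂ →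
                       (t : Touch a₁ a₂ b₁ b₂) → p₁ ≤ touchPoint t × touchPoint t ≤ p₂
  touchPoint-between p₁≤a₂ b₁≤p₂ _ _ (inj₁ a₂≡b₁) = p₁≤a₂ , subst (_≤ _) (sym a₂≡b₁) b₁≤p₂
  touchPoint-between _ _ p₁≤b₂ a₁≤p₂ (inj₂ b₂≡a₁) = subst (_ ≤_) b₂≡a₁ p₁≤b₂ , a₁≤p₂

  Contains : Rect → ℤ → ℤ → Set
  Contains r c d = (x₁ r ≤ c × c ≤ x₂ r) × (y₁ r ≤ d × d ≤ y₂ r)

  meets-both⇒contains-corner : ∀ {p r s} → Meets p r → Meets p s →
    (tx : TouchX r s) (ty : TouchY r s) → Contains p (touchPoint tx) (touchPoint ty)
  meets-both⇒contains-corner pr ps tx ty =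
    touchPoint-between (x₁r≤x₂s pr) (x₁s≤x₂r ps) (x₁r≤x₂s ps) (x₁s≤x₂r pr) tx ,
    touchPoint-between (y₁r≤y₂s pr) (y₁s≤y₂r ps) (y₁r≤y₂s ps) (y₁s≤y₂r pr) ty

  Covers : Rect → ℤ → ℤ → Set
  Covers r i j = x₁ r ≤ i × i < x₂ r × y₁ r ≤ j × j < y₂ r

  cover : ∀ {r i j} → x₁ r ≤ i × i < x₂ r → y₁ r ≤ j → j < y₂ r → Covers r i j
  cover (x₁≤i , i<x₂) y₁≤j j<y₂ = x₁≤i , i<x₂ , y₁≤j , j<y₂

  covers-disjoint : ∀ {r s i j} → InteriorsDisjoint r s → Covers r i j → Covers s i j → ⊥
  covers-disjoint (inj₁ x₂r≤x₁s) (_ , i<x₂r , _) (x₁s≤i , _) =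
    ℤ.<⇒≱ i<x₂r (ℤ.≤-trans x₂r≤x₁s x₁s≤i)
  covers-disjoint (inj₂ (inj₁ x₂s≤x₁r)) (x₁r≤i , _) (_ , i<x₂s , _) =
    ℤ.<⇒≱ i<x₂s (ℤ.≤-trans x₂s≤x₁r x₁r≤i)
  covers-disjoint (inj₂ (inj₂ (inj₁ y₂r≤y₁s))) (_ , _ , _ , j<y₂r) (_ , _ , y₁s≤j , _) =
    ℤ.<⇒≱ j<y₂r (ℤ.≤-trans y₂r≤y₁s y₁s≤j)
  covers-disjoint (inj₂ (inj₂ (inj₂ y₂s≤y₁r))) (_ , _ , y₁r≤j , _) (_ , _ , _ , j<y₂s) =
    ℤ.<⇒≱ j<y₂s (ℤ.≤-trans y₂s≤y₁r y₁r≤j)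

  unitNear : Fin 2 → ℤ → ℤ
  unitNear zero c = c
  unitNear (suc _) c = pred c

  unitNear-inside : ∀ {lo hi c} → lo < hi → lo ≤ c → c ≤ hi →
                    ∃[ b ] lo ≤ unitNear b c × unitNear b c < hi
  unitNear-inside {hi = hi} {c} lo<hi lo≤c c≤hi with c ℤ.<? hi
  ... | yes c<hi = zero , lo≤c , c<hi
  ... | no c≮hi with ℤ.≤-antisym c≤hi (ℤ.≮⇒≥ c≮hi)
  ...   | refl = suc zero , ℤ.i<j⇒i≤pred[j] lo<hi , ℤ.i≤pred[j]⇒i<j ℤ.≤-refl

  -- Each of them covers one of the four unit cells around the point, and no two the same one.
  at-most-four-at-a-point : ∀ {m c d} (f : Fin m → Rect) → (∀ i → Contains (f i) c d) →
    (∀ {i j} → i ≢ j → InteriorsDisjoint (f i) (f j)) → m ℕ.≤ 4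
  at-most-four-at-a-point {m} {c} {d} f contains disjoint = Fin.injective⇒≤ cell-injective
    where
      CoversNear : Rect → Fin 2 × Fin 2 → Set
      CoversNear r b = Covers r (unitNear (proj₁ b) c) (unitNear (proj₂ b) d)

      cell : ∀ i → Σ (Fin 2 × Fin 2) (CoversNear (f i))
      cell i =
        let (x₁≤c , c≤x₂) , (y₁≤d , d≤y₂) = contains i
            bx , x-inside = unitNear-inside (wide (f i)) x₁≤c c≤x₂
            by , y₁≤ , <y₂ = unitNear-inside (tall (f i)) y₁≤d d≤y₂
        in (bx , by) , cover {f i} x-inside y₁≤ <y₂

      code : Fin m → Fin 4
      code i = combine (proj₁ (proj₁ (cell i))) (proj₂ (proj₁ (cell i)))

      cell-injective : Injective _≡_ _≡_ code
      cell-injective {i} {j} code≡ with i Fin.≟ j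
      ... | yes i≡j = i≡j
      ... | no i≢j = ⊥-elim (covers-disjoint {f i} {f j} (disjoint i≢j) (proj₂ (cell i))
              (subst (CoversNear (f j)) (sym same-cell) (proj₂ (cell j))))
        where
          same-cell : proj₁ (cell i) ≡ proj₁ (cell j)
          same-cell with Fin.combine-injective _ _ _ _ code≡
          ... | bx≡ , by≡ = cong₂ _,_ bx≡ by≡

  same-top⇒overlapY : ∀ {r s} → y₂ r ≡ y₂ s → OverlapY r s
  same-top⇒overlapY {r} {s} y₂≡ =
    overlapY (subst (y₁ r <_) y₂≡ (tall r)) (subst (y₁ s <_) (sym y₂≡) (tall s))

  same-bottom⇒overlapY : ∀ {r s} → y₁ r ≡ y₁ s → OverlapY r s
  same-bottom⇒overlapY {r} {s} y₁≡ =
    overlapY (subst (_< y₂ s) (sym y₁≡) (tall s)) (subst (_< y₂ r) y₁≡ (tall r))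

  unit-column : ∀ {r i} → x₁ r ≡ i → x₂ r ≡ i + + 1 → x₁ r ≤ i × i < x₂ r
  unit-column {i = i} refl x₂≡ = ℤ.≤-refl , subst (i <_) (sym x₂≡) (≤⇒<+1 ℤ.≤-refl)

  overlap-unit-column : ∀ {r q i} → OverlapX r q → x₁ q ≡ i → x₂ q ≡ i + + 1 → x₁ r ≤ i × i < x₂ r
  overlap-unit-column (overlapX x₁r<x₂q x₁q<x₂r) refl x₂≡ =
    <+1⇒≤ (subst (_ <_) x₂≡ x₁r<x₂q) , x₁q<x₂r

  meets-above : ∀ {a b t} → InteriorsDisjoint b t → OverlapX b t → Meets a b → Above a t → Above b t
  meets-above {b = b} {t} disjoint x-overlap m a-above with separatedY {b} {t} disjoint x-overlap
  ... | inj₂ b-above = b-above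
  ... | inj₁ y₂b≤y₁t = contradiction (ℤ.≤-trans a-above (ℤ.≤-trans (y₁r≤y₂s m) y₂b≤y₁t)) (ℤ.<⇒≱ (tall t))

  meets-below : ∀ {a b t} → InteriorsDisjoint b t → OverlapX b t → Meets a b → Below a t → Below b t
  meets-below {b = b} {t} disjoint x-overlap m a-below with separatedY {b} {t} disjoint x-overlap
  ... | inj₁ b-below = b-below
  ... | inj₂ y₂t≤y₁b = contradiction (ℤ.≤-trans y₂t≤y₁b (ℤ.≤-trans (y₁s≤y₂r m) a-below)) (ℤ.<⇒≱ (tall t))

  module Slab (bot top : ℤ) where

    record Inside (r : Rect) : Set where
      constructor inside
      field
        bot<y₁ : bot < y₁ r
        y₂<top : y₂ r < top
    open Inside public

    two-stacked : ∀ {r s} → Inside r → y₂ r < y₁ s → Inside s → bot +[ 5 ]≤ top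
    two-stacked {r} {s} (inside bot<r _) r<s (inside _ s<top) =
      <⇒+[1]≤ bot<r ⨾ <⇒+[1]≤ (tall r) ⨾ <⇒+[1]≤ r<s ⨾ <⇒+[1]≤ (tall s) ⨾ <⇒+[1]≤ s<top

    three-in-order : ∀ {r s t} → Inside r → y₂ r ≤ y₁ s → y₂ s ≤ y₁ t → Inside t → bot +[ 5 ]≤ top
    three-in-order {r} {s} {t} (inside bot<r _) r≤s s≤t (inside _ t<top) =
      <⇒+[1]≤ bot<r ⨾ <⇒+[1]≤ (tall r) ⨾ ≤⇒+[0]≤ r≤s ⨾ <⇒+[1]≤ (tall s) ⨾
      ≤⇒+[0]≤ s≤t ⨾ <⇒+[1]≤ (tall t) ⨾ <⇒+[1]≤ t<top

    SeparatedY : Rect → Rect → Set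
    SeparatedY r s = y₂ r ≤ y₁ s ⊎ y₂ s ≤ y₁ r

    three-stacked : ∀ {r s t} → Inside r → Inside s → Inside t →
                    SeparatedY r s → SeparatedY r t → SeparatedY s t → bot +[ 5 ]≤ top
    three-stacked {s = s} r-in _ t-in (inj₁ r≤s) (inj₁ _) (inj₁ s≤t) =
      three-in-order {s = s} r-in r≤s s≤t t-in
    three-stacked {t = t} r-in s-in _ (inj₁ _) (inj₁ r≤t) (inj₂ t≤s) =
      three-in-order {s = t} r-in r≤t t≤s s-in
    three-stacked {r} _ s-in t-in (inj₁ r≤s) (inj₂ t≤r) _ =
      three-in-order {s = r} t-in t≤r r≤s s-in
    three-stacked {r} _ s-in t-in (inj₂ s≤r) (inj₁ r≤t) _ =
      three-in-order {s = r} s-in s≤r r≤t t-in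
    three-stacked {t = t} r-in s-in _ (inj₂ _) (inj₂ t≤r) (inj₁ s≤t) =
      three-in-order {s = t} s-in s≤t t≤r r-in
    three-stacked {s = s} r-in _ t-in (inj₂ s≤r) (inj₂ _) (inj₂ t≤s) =
      three-in-order {s = s} t-in t≤s s≤r r-in

module Accordion where

  open Geometry
  open import Data.Nat as ℕ using (ℕ)
  import Data.Nat.Properties as ℕ
  open import Data.Fin as Fin using (Fin; zero; suc; toℕ; _↑ˡ_)
  import Data.Fin.Properties as Fin
  open import Data.Integer using (ℤ; +_; _+_; _-_; -_; _≤_; _<_; _⊔_; _⊓_; +<+)
  import Data.Integer.Properties as ℤ
  open import Data.Integer.Solver using (module +-*-Solver)
  open +-*-Solver using (solve; _:+_; :-_; _:=_)
  open import Data.List using ([]; _∷_; map; foldr; allFin)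
  open import Data.List.Properties using (foldr-forcesᵇ; foldr-preservesᵇ)
  open import Data.List.Relation.Unary.All as All using (All)
  import Data.List.Relation.Unary.All.Properties as All
  open import Data.List.Relation.Unary.Any using (here; there)
  open import Data.List.Membership.Propositional using (_∈_)
  open import Data.List.Membership.Propositional.Properties using (∈-map⁺; ∈-++⁺ˡ; ∈-++⁺ʳ; ∈-allFin)
  open import Data.Product using (Σ; ∃-syntax; _×_; _,_; proj₁; proj₂; uncurry)
  open import Data.Sum as Sum using (_⊎_; inj₁; inj₂)
  open import Data.Empty using (⊥-elim)
  open import Function using (_∘_; id)
  open import Function.Definitions using (Injective)
  open import Relation.Nullary using (¬_; yes; no; contradiction)
  open import Relation.Binary.PropositionalEquality
    using (_≡_; _≢_; refl; sym; trans; cong; cong₂; subst; subst₂)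

  edge⇒≢ : ∀ {n} {u v : EV n} → Edge u v → u ≢ v
  edge⇒≢ (path₁ k+1≡l) refl = ℕ.1+n≢n k+1≡l
  edge⇒≢ (path₂ k+1≡l) refl = ℕ.1+n≢n k+1≡l
  edge⇒≢ (path₃ k+1≡l) refl = ℕ.1+n≢n k+1≡l
  edge⇒≢ x-p₁ ()
  edge⇒≢ x-p₂ ()
  edge⇒≢ y-p₂ ()
  edge⇒≢ y-p₃ ()
  edge⇒≢ T-p₁ ()
  edge⇒≢ B-p₃ ()

  adj⇒≢ : ∀ {n} {u v : EV n} → Adj u v → u ≢ v
  adj⇒≢ (inj₁ edge) = edge⇒≢ edge
  adj⇒≢ (inj₂ edge) = edge⇒≢ edge ∘ sym

  acc-p₁-injective : ∀ {n} {k l : Fin n} → acc (p₁ k) ≡ acc (p₁ l) → k ≡ l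
  acc-p₁-injective refl = refl

  acc-p₂-injective : ∀ {n} {k l : Fin n} → acc (p₂ k) ≡ acc (p₂ l) → k ≡ l
  acc-p₂-injective refl = refl

  acc-p₃-injective : ∀ {n} {k l : Fin n} → acc (p₃ k) ≡ acc (p₃ l) → k ≡ l
  acc-p₃-injective refl = refl

  accordion-connected : ∀ {n} (P : AccV (ℕ.suc n) → Set) →
    (∀ {a b} → Adj (acc a) (acc b) → P a → P b) → ∀ {a b} → P a → P b
  accordion-connected P step {a} {b} = from-x b ∘ to-x a
    where
      y→x : P vy → P vx
      y→x = step (inj₂ (x-p₂ {k = zero})) ∘ step (inj₁ (y-p₂ {k = zero}))

      x→y : P vx → P vy
      x→y = step (inj₂ (y-p₂ {k = zero})) ∘ step (inj₁ (x-p₂ {k = zero}))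

      to-x : ∀ a → P a → P vx
      to-x (p₁ k) = step (inj₂ x-p₁)
      to-x (p₂ k) = step (inj₂ x-p₂)
      to-x (p₃ k) = y→x ∘ step (inj₂ y-p₃)
      to-x vx = id
      to-x vy = y→x

      from-x : ∀ b → P vx → P b
      from-x (p₁ k) = step (inj₁ x-p₁)
      from-x (p₂ k) = step (inj₁ x-p₂)
      from-x (p₃ k) = step (inj₁ y-p₃) ∘ x→y
      from-x vx = id
      from-x vy = x→y

  module _ {n} (L : Layout n) where

    shares : ∀ {u v} → Adj u v → SharesSegment (R L u) (R L v)
    shares adj = adj→seg L _ _ (adj⇒≢ adj) adj

    meets : ∀ {u v} → Adj u v → Meets (R L u) (R L v)
    meets = shares⇒meets ∘ shares

    ¬adj⇒¬shares : ∀ {u v} → u ≢ v → ¬ Adj u v → ¬ SharesSegment (R L u) (R L v)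
    ¬adj⇒¬shares u≢v ¬adj = ¬adj ∘ seg→adj L _ _ u≢v

  module _ {A : Set} (f : A → ℤ) where

    foldr-⊔-upper : ∀ e xs → All (λ x → f x ≤ foldr _⊔_ e (map f xs)) xs
    foldr-⊔-upper e xs = All.map⁻ (foldr-forcesᵇ {P = _≤ foldr _⊔_ e (map f xs)}
      (λ x y ⊔≤ → ℤ.i⊔j≤k⇒i≤k x y ⊔≤ , ℤ.i⊔j≤k⇒j≤k x y ⊔≤) e (map f xs) ℤ.≤-refl)

    foldr-⊔-least : ∀ {t} e xs → e ≤ t → (∀ x → f x ≤ t) → foldr _⊔_ e (map f xs) ≤ t
    foldr-⊔-least {t} e xs e≤t f≤t =
      foldr-preservesᵇ {P = _≤ t} ℤ.⊔-lub e≤t (All.map⁺ (All.universal f≤t xs))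

    foldr-⊓-lower : ∀ e xs → All (λ x → foldr _⊓_ e (map f xs) ≤ f x) xs
    foldr-⊓-lower e xs = All.map⁻ (foldr-forcesᵇ {P = foldr _⊓_ e (map f xs) ≤_}
      (λ x y ≤⊓ → ℤ.i≤j⊓k⇒i≤j x y ≤⊓ , ℤ.i≤j⊓k⇒i≤k x y ≤⊓) e (map f xs) ℤ.≤-refl)

    foldr-⊓-greatest : ∀ {t} e xs → t ≤ e → (∀ x → t ≤ f x) → t ≤ foldr _⊓_ e (map f xs)
    foldr-⊓-greatest {t} e xs t≤e t≤f =
      foldr-preservesᵇ {P = t ≤_} ℤ.⊓-glb t≤e (All.map⁺ (All.universal t≤f xs))

    neg-foldr-⊓ : ∀ e xs → foldr _⊔_ (- e) (map (λ x → - f x) xs) ≡ - foldr _⊓_ e (map f xs)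
    neg-foldr-⊓ e [] = refl
    neg-foldr-⊓ e (x ∷ xs) =
      trans (cong (- f x ⊔_) (neg-foldr-⊓ e xs)) (sym (ℤ.neg-distrib-⊓-⊔ (f x) _))

    neg-foldr-⊔ : ∀ e xs → foldr _⊓_ (- e) (map (λ x → - f x) xs) ≡ - foldr _⊔_ e (map f xs)
    neg-foldr-⊔ e [] = refl
    neg-foldr-⊔ e (x ∷ xs) =
      trans (cong (- f x ⊓_) (neg-foldr-⊔ e xs)) (sym (ℤ.neg-distrib-⊔-⊓ (f x) _))

  ∈-accList : ∀ {n} (a : AccV n) → a ∈ accList n
  ∈-accList {n} (p₁ k) = ∈-++⁺ˡ (∈-map⁺ p₁ (∈-allFin k))
  ∈-accList {n} (p₂ k) = ∈-++⁺ʳ (map p₁ (allFin n)) (∈-++⁺ˡ (∈-map⁺ p₂ (∈-allFin k)))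
  ∈-accList {n} (p₃ k) =
    ∈-++⁺ʳ (map p₁ (allFin n)) (∈-++⁺ʳ (map p₂ (allFin n)) (∈-++⁺ˡ (∈-map⁺ p₃ (∈-allFin k))))
  ∈-accList {n} vx =
    ∈-++⁺ʳ (map p₁ (allFin n)) (∈-++⁺ʳ (map p₂ (allFin n)) (∈-++⁺ʳ (map p₃ (allFin n)) (here refl)))
  ∈-accList {n} vy = ∈-++⁺ʳ (map p₁ (allFin n))
    (∈-++⁺ʳ (map p₂ (allFin n)) (∈-++⁺ʳ (map p₃ (allFin n)) (there (here refl))))

  module _ {n} (L : Layout n) where

    private
      RA : AccV n → Rect
      RA a = R L (acc a)

    bbLeft≤x₁ : ∀ a → bbLeft L ≤ x₁ (RA a)
    bbLeft≤x₁ a = All.lookup (foldr-⊓-lower (x₁ ∘ RA) _ _) (∈-accList a)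

    x₂≤bbRight : ∀ a → x₂ (RA a) ≤ bbRight L
    x₂≤bbRight a = All.lookup (foldr-⊔-upper (x₂ ∘ RA) _ _) (∈-accList a)

    bbBottom≤y₁ : ∀ a → bbBottom L ≤ y₁ (RA a)
    bbBottom≤y₁ a = All.lookup (foldr-⊓-lower (y₁ ∘ RA) _ _) (∈-accList a)

    y₂≤bbTop : ∀ a → y₂ (RA a) ≤ bbTop L
    y₂≤bbTop a = All.lookup (foldr-⊔-upper (y₂ ∘ RA) _ _) (∈-accList a)

    bbTop≤ : ∀ {t} → (∀ a → y₂ (RA a) ≤ t) → bbTop L ≤ t
    bbTop≤ y₂≤t = foldr-⊔-least (y₂ ∘ RA) _ (accList n) (y₂≤t vx) y₂≤t

    ≤bbBottom : ∀ {t} → (∀ a → t ≤ y₁ (RA a)) → t ≤ bbBottom L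
    ≤bbBottom t≤y₁ = foldr-⊓-greatest (y₁ ∘ RA) _ (accList n) (t≤y₁ vx) t≤y₁

    bbLeft<bbRight : bbLeft L < bbRight L
    bbLeft<bbRight = ℤ.≤-<-trans (bbLeft≤x₁ vx) (ℤ.<-≤-trans (wide (RA vx)) (x₂≤bbRight vx))

  VerticalBounds : ∀ {n} → Layout n → Set
  VerticalBounds {n} L =
    (+ 5 ≤ bbHeight L) × (+ n ≤ bbWidth L) × (bbHeight L ≡ + 5 → bbWidth L ≡ + n → Dissection L)

  module TAboveB {n′} (L : Layout (3 ℕ.+ n′)) (T-above-B : Above (R L vT) (R L vB))
    (overlaps : ∀ a → OverlapX (R L (acc a)) (R L vT) × OverlapX (R L (acc a)) (R L vB)) where

    private
      n : ℕ
      n = 3 ℕ.+ n′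

      RA : AccV n → Rect
      RA a = R L (acc a)

      rT rB rX rY : Rect
      rT = R L vT
      rB = R L vB
      rX = RA vx
      rY = RA vy

      P₁ P₂ P₃ : Fin n → Rect
      P₁ k = RA (p₁ k)
      P₂ k = RA (p₂ k)
      P₃ k = RA (p₃ k)

      top bot : ℤ
      top = y₁ rT
      bot = y₂ rB

    above-T-step : ∀ {a b} → Adj (acc a) (acc b) → Above (RA a) rT → Above (RA b) rT
    above-T-step {b = b} adj =
      meets-above {b = RA b} (disjoint L (acc b) vT (λ ())) (proj₁ (overlaps b)) (meets L adj)

    below-B-step : ∀ {a b} → Adj (acc a) (acc b) → Below (RA a) rB → Below (RA b) rB
    below-B-step {b = b} adj =
      meets-below {b = RA b} (disjoint L (acc b) vB (λ ())) (proj₂ (overlaps b)) (meets L adj)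

    P₃-not-above-T : ¬ Above (P₃ zero) rT
    P₃-not-above-T P₃-above-T = ℤ.<⇒≱ (tall rT)
      (ℤ.≤-trans P₃-above-T (ℤ.≤-trans (y₁r≤y₂s (meets L (inj₂ B-p₃))) T-above-B))

    P₁-not-below-B : ¬ Below (P₁ zero) rB
    P₁-not-below-B P₁-below-B = ℤ.<⇒≱ (tall rB)
      (ℤ.≤-trans T-above-B (ℤ.≤-trans (y₁s≤y₂r (meets L (inj₂ T-p₁))) P₁-below-B))

    -- Lying above T spreads along adjacencies and would reach p₃, which touches B below T.
    below-T : ∀ a → Below (RA a) rT
    below-T a with separatedY {RA a} {rT} (disjoint L (acc a) vT (λ ())) (proj₁ (overlaps a))
    ... | inj₁ below = below
    ... | inj₂ above =
      contradiction (accordion-connected _ above-T-step {b = p₃ zero} above) P₃-not-above-T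

    above-B : ∀ a → Above (RA a) rB
    above-B a with separatedY {RA a} {rB} (disjoint L (acc a) vB (λ ())) (proj₂ (overlaps a))
    ... | inj₂ above = above
    ... | inj₁ below =
      contradiction (accordion-connected _ below-B-step {b = p₁ zero} below) P₁-not-below-B

    P₁-top : ∀ k → y₂ (P₁ k) ≡ top
    P₁-top k = shares-below⇒touch {P₁ k} {rT} (shares L (inj₂ T-p₁)) (below-T (p₁ k))

    P₃-bottom : ∀ k → y₁ (P₃ k) ≡ bot
    P₃-bottom k = sym (shares-below⇒touch {rB} {P₃ k} (shares L (inj₁ B-p₃)) (above-B (p₃ k)))

    open Slab bot top

    inner : ∀ a → ¬ Adj (acc a) vT → ¬ Adj (acc a) vB → Inside (RA a)
    inner a ¬T ¬B = inside
      (ℤ.≤∧≢⇒< (above-B a) (λ touch → ¬adj⇒¬shares L (λ ()) ¬B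
        (touchY⇒shares (proj₂ (overlaps a)) (inj₂ touch))))
      (ℤ.≤∧≢⇒< (below-T a) (λ touch → ¬adj⇒¬shares L (λ ()) ¬T
        (touchY⇒shares (proj₁ (overlaps a)) (inj₁ touch))))

    X-inside : Inside rX
    X-inside = inner vx (λ { (inj₁ ()) ; (inj₂ ()) }) (λ { (inj₁ ()) ; (inj₂ ()) })

    Y-inside : Inside rY
    Y-inside = inner vy (λ { (inj₁ ()) ; (inj₂ ()) }) (λ { (inj₁ ()) ; (inj₂ ()) })

    P₂-inside : ∀ k → Inside (P₂ k)
    P₂-inside k = inner (p₂ k) (λ { (inj₁ ()) ; (inj₂ ()) }) (λ { (inj₁ ()) ; (inj₂ ()) })

    bbTop≡top : bbTop L ≡ top
    bbTop≡top = ℤ.≤-antisym (bbTop≤ L below-T) (subst (_≤ bbTop L) (P₁-top zero) (y₂≤bbTop L (p₁ zero)))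

    bbBottom≡bot : bbBottom L ≡ bot
    bbBottom≡bot =
      ℤ.≤-antisym (subst (bbBottom L ≤_) (P₃-bottom zero) (bbBottom≤y₁ L (p₃ zero))) (≤bbBottom L above-B)

    bbHeight≡ : bbHeight L ≡ top - bot
    bbHeight≡ = cong₂ _-_ bbTop≡top bbBottom≡bot

    X-Y-disjoint : InteriorsDisjoint rX rY
    X-Y-disjoint = disjoint L (acc vx) (acc vy) (λ ())

    X-Y-¬shares : ¬ SharesSegment rX rY
    X-Y-¬shares = ¬adj⇒¬shares L (λ ()) (λ { (inj₁ ()) ; (inj₂ ()) })

    X-meets-P₂ : ∀ k → Meets rX (P₂ k)
    X-meets-P₂ k = meets L (inj₁ x-p₂)

    Y-meets-P₂ : ∀ k → Meets rY (P₂ k)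
    Y-meets-P₂ k = meets L (inj₁ y-p₂)

    P₂-disjoint : ∀ {k l} → k ≢ l → InteriorsDisjoint (P₂ k) (P₂ l)
    P₂-disjoint k≢l = disjoint L _ _ (k≢l ∘ acc-p₂-injective)

    -- Rectangles meeting both A and a B strictly right of A overlap horizontally, so they stack.
    P₂-stacked : ∀ {A B} → x₂ A < x₁ B → (∀ k → Meets A (P₂ k)) → (∀ k → Meets B (P₂ k)) →
                 bot +[ 5 ]≤ top
    P₂-stacked {A} {B} A-left-of-B A-meets B-meets =
      three-stacked (P₂-inside zero) (P₂-inside (suc zero)) (P₂-inside (suc (suc zero)))
        (separated (λ ())) (separated (λ ())) (separated (λ ()))
      where
        x₁P₂<x₂P₂ : ∀ k l → x₁ (P₂ k) < x₂ (P₂ l)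
        x₁P₂<x₂P₂ k l =
          ℤ.≤-<-trans (x₁s≤x₂r (A-meets k)) (ℤ.<-≤-trans A-left-of-B (x₁r≤x₂s (B-meets l)))

        separated : ∀ {k l} → k ≢ l → SeparatedY (P₂ k) (P₂ l)
        separated {k} {l} k≢l =
          separatedY {P₂ k} {P₂ l} (P₂-disjoint k≢l) (overlapX (x₁P₂<x₂P₂ k l) (x₁P₂<x₂P₂ l k))

    corner-family : Fin 5 → EV n
    corner-family zero = acc vx
    corner-family (suc zero) = acc vy
    corner-family (suc (suc k)) = acc (p₂ (k ↑ˡ n′))

    corner-family-injective : Injective _≡_ _≡_ corner-family
    corner-family-injective {zero} {zero} _ = refl
    corner-family-injective {suc zero} {suc zero} _ = refl
    corner-family-injective {suc (suc k)} {suc (suc l)} eq =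
      cong (suc ∘ suc) (Fin.↑ˡ-injective n′ k l (acc-p₂-injective eq))
    corner-family-injective {zero} {suc zero} ()
    corner-family-injective {zero} {suc (suc _)} ()
    corner-family-injective {suc zero} {zero} ()
    corner-family-injective {suc zero} {suc (suc _)} ()
    corner-family-injective {suc (suc _)} {zero} ()
    corner-family-injective {suc (suc _)} {suc zero} ()

    -- x and y would meet at a corner that also lies in all three p₂, i.e. in five rectangles.
    X-Y-¬meet : ¬ Meets rX rY
    X-Y-¬meet m = ℕ.1+n≰n (at-most-four-at-a-point (R L ∘ corner-family) contains
      (λ i≢j → disjoint L _ _ (i≢j ∘ corner-family-injective)))
      where
        tx : TouchX rX rY
        tx = proj₁ (corner m X-Y-¬shares X-Y-disjoint)

        ty : TouchY rX rY
        ty = proj₂ (corner m X-Y-¬shares X-Y-disjoint)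

        contains : ∀ i → Contains (R L (corner-family i)) (touchPoint tx) (touchPoint ty)
        contains zero = meets-both⇒contains-corner (meets-refl rX) m tx ty
        contains (suc zero) = meets-both⇒contains-corner (meets-sym m) (meets-refl rY) tx ty
        contains (suc (suc k)) =
          meets-both⇒contains-corner (meets L (inj₂ x-p₂)) (meets L (inj₂ y-p₂)) tx ty

    height : bot +[ 5 ]≤ top
    height with y₂ rX ℤ.<? y₁ rY | y₂ rY ℤ.<? y₁ rX | x₂ rX ℤ.<? x₁ rY | x₂ rY ℤ.<? x₁ rX
    ... | yes X-below-Y | _ | _ | _ = two-stacked X-inside X-below-Y Y-inside
    ... | no _ | yes Y-below-X | _ | _ = two-stacked Y-inside Y-below-X X-inside
    ... | no _ | no _ | yes X-left-of-Y | _ = P₂-stacked X-left-of-Y X-meets-P₂ Y-meets-P₂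
    ... | no _ | no _ | no _ | yes Y-left-of-X = P₂-stacked Y-left-of-X Y-meets-P₂ X-meets-P₂
    ... | no ¬X-below-Y | no ¬Y-below-X | no ¬X-left-of-Y | no ¬Y-left-of-X = ⊥-elim (X-Y-¬meet (record
      { x₁r≤x₂s = ℤ.≮⇒≥ ¬Y-left-of-X ; x₁s≤x₂r = ℤ.≮⇒≥ ¬X-left-of-Y
      ; y₁r≤y₂s = ℤ.≮⇒≥ ¬Y-below-X ; y₁s≤y₂r = ℤ.≮⇒≥ ¬X-below-Y }))

    P₁-separated : ∀ {k l} → k ≢ l → x₂ (P₁ k) ≤ x₁ (P₁ l) ⊎ x₂ (P₁ l) ≤ x₁ (P₁ k)
    P₁-separated {k} {l} k≢l = separatedX {P₁ k} {P₁ l} (disjoint L _ _ (k≢l ∘ acc-p₁-injective))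
      (same-top⇒overlapY (trans (P₁-top k) (sym (P₁-top l))))

    P₃-separated : ∀ {k l} → k ≢ l → x₂ (P₃ k) ≤ x₁ (P₃ l) ⊎ x₂ (P₃ l) ≤ x₁ (P₃ k)
    P₃-separated {k} {l} k≢l = separatedX {P₃ k} {P₃ l} (disjoint L _ _ (k≢l ∘ acc-p₃-injective))
      (same-bottom⇒overlapY (trans (P₃-bottom k) (sym (P₃-bottom l))))

    module Columns₁ = DisjointIntervals (x₁ ∘ P₁) (x₂ ∘ P₁) (wide ∘ P₁) P₁-separated
      (ℤ.<⇒≤ (bbLeft<bbRight L)) (bbLeft≤x₁ L ∘ p₁) (x₂≤bbRight L ∘ p₁)
    module Columns₃ = DisjointIntervals (x₁ ∘ P₃) (x₂ ∘ P₃) (wide ∘ P₃) P₃-separated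
      (ℤ.<⇒≤ (bbLeft<bbRight L)) (bbLeft≤x₁ L ∘ p₃) (x₂≤bbRight L ∘ p₃)

    module Tight (height≡5 : bbHeight L ≡ + 5) (width≡n : bbWidth L ≡ + n) where

      private
        Lb Rb : ℤ
        Lb = bbLeft L
        Rb = bbRight L

      top≡ : top ≡ bot + + 5
      top≡ = b-a≡k⇒b≡a+k (trans (sym bbHeight≡) height≡5)

      UnitColumn : (Fin n → Rect) → ℤ → Set
      UnitColumn F i = ∃[ k ] x₁ (F k) ≡ i × x₂ (F k) ≡ i + + 1

      Tiles : (Fin n → Rect) → Set
      Tiles F = ∀ i → Lb ≤ i → i < Rb → UnitColumn F i

      column-in-box : ∀ m → m ℕ.< n → Lb ≤ Lb + + m × Lb + + m < Rb
      column-in-box m m<n =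
        ℤ.i≤i+j Lb (+ m) , subst (Lb + + m <_) (sym (b-a≡k⇒b≡a+k width≡n)) (ℤ.+-monoʳ-< Lb (+<+ m<n))

      Spans : Rect → Set
      Spans r = x₁ r ≤ Lb + + 1 × Lb + + (2 ℕ.+ n′) ≤ x₂ r

      spans : ∀ {F r} → Tiles F → (∀ k → Meets r (F k)) → Spans r
      spans {F} {r} tiles r-meets = first , last
        where
          first : x₁ r ≤ Lb + + 1
          first with tiles Lb ℤ.≤-refl (bbLeft<bbRight L)
          ... | k , _ , x₂≡ = subst (x₁ r ≤_) x₂≡ (x₁r≤x₂s (r-meets k))

          last : Lb + + (2 ℕ.+ n′) ≤ x₂ r
          last with uncurry (tiles (Lb + + (2 ℕ.+ n′))) (column-in-box (2 ℕ.+ n′) (ℕ.n<1+n _))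
          ... | k , x₁≡ , _ = subst (_≤ x₂ r) x₁≡ (x₁s≤x₂r (r-meets k))

      1<last : Lb + + 1 < Lb + + (2 ℕ.+ n′)
      1<last = ℤ.+-monoʳ-< Lb (+<+ (ℕ.s≤s (ℕ.s≤s ℕ.z≤n)))

      spans⇒overlap : ∀ {r s} → Spans r → Spans s → OverlapX r s
      spans⇒overlap (r₁ , r₂) (s₁ , s₂) =
        overlapX (ℤ.≤-<-trans r₁ (ℤ.<-≤-trans 1<last s₂)) (ℤ.≤-<-trans s₁ (ℤ.<-≤-trans 1<last r₂))

      second-column-overlap : ∀ {q r} → x₁ q ≡ Lb + + 1 → x₂ q ≡ Lb + + 1 + + 1 → Spans r → OverlapX q r
      second-column-overlap refl refl (r₁ , r₂) = overlapX (ℤ.<-≤-trans 1<last r₂) (≤⇒<+1 r₁)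

      column₁ : Tiles P₁
      column₁ = Columns₁.tile width≡n

      column₃ : Tiles P₃
      column₃ = Columns₃.tile width≡n

      X-spans : Spans rX
      X-spans = spans column₁ (λ k → meets L (inj₁ x-p₁))

      Y-spans : Spans rY
      Y-spans = spans column₃ (λ k → meets L (inj₁ y-p₃))

      X-Y-overlap : OverlapX rX rY
      X-Y-overlap = spans⇒overlap X-spans Y-spans

      -- A p₁ in the second column lies above y yet meets x, so y cannot be above x.
      second-column-P₁⇒¬Y-above-X : UnitColumn P₁ (Lb + + 1) → ¬ (y₂ rX ≤ y₁ rY)
      second-column-P₁⇒¬Y-above-X (k , x₁≡ , x₂≡) X≤Y = Sum.[ P₁-not-below-Y , Y-not-below-P₁ ]′
        (separatedY {P₁ k} {rY} (disjoint L _ _ (λ ())) (second-column-overlap x₁≡ x₂≡ Y-spans))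
        where
          P₁-not-below-Y : ¬ (y₂ (P₁ k) ≤ y₁ rY)
          P₁-not-below-Y P₁≤Y = ℤ.<⇒≱ (ℤ.<-trans (tall rY) (y₂<top Y-inside))
            (subst (_≤ y₁ rY) (P₁-top k) P₁≤Y)

          Y-not-below-P₁ : ¬ (y₂ rY ≤ y₁ (P₁ k))
          Y-not-below-P₁ Y≤P₁ = ℤ.<⇒≱ (tall rY)
            (ℤ.≤-trans Y≤P₁ (ℤ.≤-trans (y₁s≤y₂r (meets L (inj₁ (x-p₁ {k = k})))) X≤Y))

      Y-below-X : y₂ rY < y₁ rX
      Y-below-X = Sum.[ ⊥-elim ∘ second-column-P₁⇒¬Y-above-X second-column , Y-strictly-below ]′
        (separatedY X-Y-disjoint X-Y-overlap)
        where
          second-column : UnitColumn P₁ (Lb + + 1)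
          second-column = uncurry (column₁ (Lb + + 1)) (column-in-box 1 (ℕ.s≤s (ℕ.s≤s ℕ.z≤n)))

          Y-strictly-below : y₂ rY ≤ y₁ rX → y₂ rY < y₁ rX
          Y-strictly-below Y≤X = ℤ.≤∧≢⇒< Y≤X
            (λ touch → X-Y-¬shares (touchY⇒shares X-Y-overlap (inj₂ touch)))

      rows : y₁ rY ≡ bot + + 1 × y₂ rY ≡ bot + + 2 × y₁ rX ≡ bot + + 3 × y₂ rX ≡ bot + + 4
      rows = five-unit-steps (bot<y₁ Y-inside) (tall rY) Y-below-X (tall rX)
        (y₂<top X-inside) (ℤ.≤-reflexive top≡)

      y₁Y≡ : y₁ rY ≡ bot + + 1
      y₁Y≡ = proj₁ rows

      y₂Y≡ : y₂ rY ≡ bot + + 2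
      y₂Y≡ = proj₁ (proj₂ rows)

      y₁X≡ : y₁ rX ≡ bot + + 3
      y₁X≡ = proj₁ (proj₂ (proj₂ rows))

      y₂X≡ : y₂ rX ≡ bot + + 4
      y₂X≡ = proj₂ (proj₂ (proj₂ rows))

      y₂X≡y₁X+1 : y₂ rX ≡ y₁ rX + + 1
      y₂X≡y₁X+1 = next-step {b = bot} {k = 3} y₁X≡ y₂X≡

      top≡y₂X+1 : top ≡ y₂ rX + + 1
      top≡y₂X+1 = next-step {b = bot} {k = 4} y₂X≡ top≡

      P₂-separated : ∀ {k l} → k ≢ l → x₂ (P₂ k) ≤ x₁ (P₂ l) ⊎ x₂ (P₂ l) ≤ x₁ (P₂ k)
      P₂-separated {k} {l} k≢l = separatedX {P₂ k} {P₂ l} (P₂-disjoint k≢l)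
        (overlapY (y₁P₂<y₂P₂ k l) (y₁P₂<y₂P₂ l k))
        where
          y₁P₂<y₂P₂ : ∀ k l → y₁ (P₂ k) < y₂ (P₂ l)
          y₁P₂<y₂P₂ k l =
            ℤ.≤-<-trans (y₁s≤y₂r (Y-meets-P₂ k)) (ℤ.<-≤-trans Y-below-X (y₁r≤y₂s (X-meets-P₂ l)))

      module Columns₂ = DisjointIntervals (x₁ ∘ P₂) (x₂ ∘ P₂) (wide ∘ P₂) P₂-separated
        (ℤ.<⇒≤ (bbLeft<bbRight L)) (bbLeft≤x₁ L ∘ p₂) (x₂≤bbRight L ∘ p₂)

      column₂ : Tiles P₂
      column₂ = Columns₂.tile width≡n

      Covered : ℤ → ℤ → Set
      Covered i j = ∃[ a ] Covers (RA a) i j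

      bottom-row : ∀ {i} → UnitColumn P₃ i → Covered i bot
      bottom-row (k , x₁≡ , x₂≡) = p₃ k , cover {P₃ k} (unit-column {P₃ k} x₁≡ x₂≡)
        (ℤ.≤-reflexive (P₃-bottom k)) (subst (_< y₂ (P₃ k)) (P₃-bottom k) (tall (P₃ k)))

      Y-row : ∀ {i} → UnitColumn P₃ i → Covered i (y₁ rY)
      Y-row {i} (k , x₁≡ , x₂≡) = Sum.[ by-P₃ , by-Y ]′ (shares⇒overlap (shares L (inj₁ (y-p₃ {k = k}))))
        where
          by-P₃ : OverlapY rY (P₃ k) → Covered i (y₁ rY)
          by-P₃ (overlapY y₁Y<y₂P₃ _) = p₃ k , cover {P₃ k} (unit-column {P₃ k} x₁≡ x₂≡)
            (subst (_≤ y₁ rY) (sym (P₃-bottom k)) (above-B vy)) y₁Y<y₂P₃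

          by-Y : OverlapX rY (P₃ k) → Covered i (y₁ rY)
          by-Y Y-P₃-overlap =
            vy , cover {rY} (overlap-unit-column Y-P₃-overlap x₁≡ x₂≡) ℤ.≤-refl (tall rY)

      middle-row : ∀ {i} → UnitColumn P₂ i → Covered i (y₂ rY)
      middle-row (k , x₁≡ , x₂≡) = p₂ k , cover {P₂ k} (unit-column {P₂ k} x₁≡ x₂≡)
        (y₁s≤y₂r (Y-meets-P₂ k)) (ℤ.<-≤-trans Y-below-X (y₁r≤y₂s (X-meets-P₂ k)))

      X-row : ∀ {i} → UnitColumn P₁ i → Covered i (y₁ rX)
      X-row {i} (k , x₁≡ , x₂≡) = Sum.[ by-P₁ , by-X ]′ (shares⇒overlap (shares L (inj₁ (x-p₁ {k = k}))))
        where
          by-P₁ : OverlapY rX (P₁ k) → Covered i (y₁ rX)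
          by-P₁ (overlapY y₁X<y₂P₁ y₁P₁<y₂X) = p₁ k , cover {P₁ k} (unit-column {P₁ k} x₁≡ x₂≡)
            (<+1⇒≤ (subst (y₁ (P₁ k) <_) y₂X≡y₁X+1 y₁P₁<y₂X)) y₁X<y₂P₁

          by-X : OverlapX rX (P₁ k) → Covered i (y₁ rX)
          by-X X-P₁-overlap =
            vx , cover {rX} (overlap-unit-column X-P₁-overlap x₁≡ x₂≡) ℤ.≤-refl (tall rX)

      top-row : ∀ {i} → UnitColumn P₁ i → Covered i (y₂ rX)
      top-row (k , x₁≡ , x₂≡) = p₁ k , cover {P₁ k} (unit-column {P₁ k} x₁≡ x₂≡)
        (<+1⇒≤ (subst (y₁ (P₁ k) <_) (trans (P₁-top k) top≡y₂X+1) (tall (P₁ k))))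
        (subst (y₂ rX <_) (sym (P₁-top k)) (y₂<top X-inside))

      cell : ∀ {i} → UnitColumn P₁ i → UnitColumn P₂ i → UnitColumn P₃ i →
             ∀ (m : Fin 5) → Covered i (bot + + toℕ m)
      cell _ _ c₃ zero = subst (Covered _) (sym (ℤ.+-identityʳ bot)) (bottom-row c₃)
      cell _ _ c₃ (suc zero) = subst (Covered _) y₁Y≡ (Y-row c₃)
      cell _ c₂ _ (suc (suc zero)) = subst (Covered _) y₂Y≡ (middle-row c₂)
      cell c₁ _ _ (suc (suc (suc zero))) = subst (Covered _) y₁X≡ (X-row c₁)
      cell c₁ _ _ (suc (suc (suc (suc zero)))) = subst (Covered _) y₂X≡ (top-row c₁)

      dissection : Dissection L
      dissection i j Lb≤i i<Rb bbBottom≤j j<bbTop =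
        subst (λ j → ∃[ a ] Covers (RA a) i j) (proj₂ row)
          (cell (column₁ i Lb≤i i<Rb) (column₂ i Lb≤i i<Rb) (column₃ i Lb≤i i<Rb) (proj₁ row))
        where
          row : Σ (Fin 5) (λ m → bot + + toℕ m ≡ j)
          row = window-index (subst (_≤ j) bbBottom≡bot bbBottom≤j)
                             (subst (j <_) (trans bbTop≡top top≡) j<bbTop)

    bounds : VerticalBounds L
    bounds = subst (+ 5 ≤_) (sym bbHeight≡) (+[]≤⇒≤- height) , Columns₁.count , Tight.dissection

  HorizontalBounds : ∀ {n} → Layout n → Set
  HorizontalBounds {n} L =
    (+ n ≤ bbHeight L) × (+ 5 ≤ bbWidth L) × (bbHeight L ≡ + n → bbWidth L ≡ + 5 → Dissection L)

  Unflanked : ∀ {n} → Layout n → Set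
  Unflanked L = ∀ a → ¬ LeftOf (R L (acc a)) (R L vT) × ¬ RightOf (R L (acc a)) (R L vT)
                    × ¬ LeftOf (R L (acc a)) (R L vB) × ¬ RightOf (R L (acc a)) (R L vB)

  unflanked⇒overlaps : ∀ {n} {L : Layout n} → Unflanked L →
    ∀ a → OverlapX (R L (acc a)) (R L vT) × OverlapX (R L (acc a)) (R L vB)
  unflanked⇒overlaps unflanked a with unflanked a
  ... | ¬left-T , ¬right-T , ¬left-B , ¬right-B =
    overlapX (ℤ.≰⇒> ¬right-T) (ℤ.≰⇒> ¬left-T) , overlapX (ℤ.≰⇒> ¬right-B) (ℤ.≰⇒> ¬left-B)

  flipR : Rect → Rect
  flipR r = record
    { x₁ = x₁ r ; x₂ = x₂ r ; y₁ = - y₂ r ; y₂ = - y₁ r ; wide = wide r ; tall = ℤ.neg-mono-< (tall r) }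

  flip-disjoint : ∀ {r s} → InteriorsDisjoint r s → InteriorsDisjoint (flipR r) (flipR s)
  flip-disjoint (inj₁ x₂r≤x₁s) = inj₁ x₂r≤x₁s
  flip-disjoint (inj₂ (inj₁ x₂s≤x₁r)) = inj₂ (inj₁ x₂s≤x₁r)
  flip-disjoint (inj₂ (inj₂ (inj₁ y₂r≤y₁s))) = inj₂ (inj₂ (inj₂ (ℤ.neg-mono-≤ y₂r≤y₁s)))
  flip-disjoint (inj₂ (inj₂ (inj₂ y₂s≤y₁r))) = inj₂ (inj₂ (inj₁ (ℤ.neg-mono-≤ y₂s≤y₁r)))

  neg-⊔<⊓ : ∀ {a b c d} → a ⊔ b < c ⊓ d → - c ⊔ - d < - a ⊓ - b
  neg-⊔<⊓ {a} {b} {c} {d} ⊔<⊓ =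
    subst₂ _<_ (ℤ.neg-distrib-⊓-⊔ c d) (ℤ.neg-distrib-⊔-⊓ a b) (ℤ.neg-mono-< ⊔<⊓)

  neg-⊔<⊓⁻¹ : ∀ {a b c d} → - c ⊔ - d < - a ⊓ - b → a ⊔ b < c ⊓ d
  neg-⊔<⊓⁻¹ {a} {b} {c} {d} ⊔<⊓ = subst₂ _<_
    (cong₂ _⊔_ (ℤ.neg-involutive a) (ℤ.neg-involutive b))
    (cong₂ _⊓_ (ℤ.neg-involutive c) (ℤ.neg-involutive d)) (neg-⊔<⊓ ⊔<⊓)

  flip-shares : ∀ {r s} → SharesSegment r s → SharesSegment (flipR r) (flipR s)
  flip-shares (inj₁ (touch , ⊔<⊓)) = inj₁ (touch , neg-⊔<⊓ ⊔<⊓)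
  flip-shares (inj₂ (inj₁ y₂r≡y₁s , ⊔<⊓)) = inj₂ (inj₂ (cong -_ (sym y₂r≡y₁s)) , ⊔<⊓)
  flip-shares (inj₂ (inj₂ y₂s≡y₁r , ⊔<⊓)) = inj₂ (inj₁ (cong -_ (sym y₂s≡y₁r)) , ⊔<⊓)

  flip-shares⁻¹ : ∀ {r s} → SharesSegment (flipR r) (flipR s) → SharesSegment r s
  flip-shares⁻¹ (inj₁ (touch , ⊔<⊓)) = inj₁ (touch , neg-⊔<⊓⁻¹ ⊔<⊓)
  flip-shares⁻¹ (inj₂ (inj₁ -y₁r≡-y₂s , ⊔<⊓)) = inj₂ (inj₂ (sym (ℤ.neg-injective -y₁r≡-y₂s)) , ⊔<⊓)
  flip-shares⁻¹ (inj₂ (inj₂ -y₁s≡-y₂r , ⊔<⊓)) = inj₂ (inj₁ (sym (ℤ.neg-injective -y₁s≡-y₂r)) , ⊔<⊓)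

  flipL : ∀ {n} → Layout n → Layout n
  flipL L = record
    { R = flipR ∘ R L
    ; disjoint = λ u v u≢v → flip-disjoint {R L u} {R L v} (disjoint L u v u≢v)
    ; adj→seg = λ u v u≢v adj → flip-shares {R L u} {R L v} (adj→seg L u v u≢v adj)
    ; seg→adj = λ u v u≢v shares → seg→adj L u v u≢v (flip-shares⁻¹ {R L u} {R L v} shares)
    }

  module _ {n} (L : Layout n) where

    flip-bbTop : bbTop (flipL L) ≡ - bbBottom L
    flip-bbTop = neg-foldr-⊓ (λ a → y₁ (R L (acc a))) _ (accList n)

    flip-bbBottom : bbBottom (flipL L) ≡ - bbTop L
    flip-bbBottom = neg-foldr-⊔ (λ a → y₂ (R L (acc a))) _ (accList n)

    flip-bbHeight : bbHeight (flipL L) ≡ bbHeight L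
    flip-bbHeight = trans (cong₂ _-_ flip-bbTop flip-bbBottom) (-b--t≡t-b (bbTop L) (bbBottom L))
      where
        -b--t≡t-b : ∀ t b → - b - - t ≡ t - b
        -b--t≡t-b = solve 2 (λ t b → (:- b) :+ (:- (:- t)) := t :+ (:- b)) refl

    -- Cell row j of L is cell row -(j + 1) of the flipped layout.
    flip-dissection : Dissection (flipL L) → Dissection L
    flip-dissection dissection i j Lb≤i i<Rb bbBottom≤j j<bbTop
      with dissection i (- (j + + 1)) Lb≤i i<Rb
             (subst (_≤ _) (sym flip-bbBottom) (ℤ.neg-mono-≤ (<⇒+1≤ j<bbTop)))
             (subst (_ <_) (sym flip-bbTop) (ℤ.neg-mono-< (≤⇒<+1 bbBottom≤j)))
    ... | a , x₁≤i , i<x₂ , -y₂≤ , <-y₁ =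
      a , x₁≤i , i<x₂ , <+1⇒≤ (ℤ.neg-cancel-< <-y₁) , +1≤⇒< (ℤ.neg-cancel-≤ -y₂≤)

    flip-bounds : VerticalBounds (flipL L) → VerticalBounds L
    flip-bounds (height , width , dissection) =
      subst (+ 5 ≤_) flip-bbHeight height , width ,
      λ height≡ width≡ → flip-dissection (dissection (trans flip-bbHeight height≡) width≡)

  swapR : Rect → Rect
  swapR r = record { x₁ = y₁ r ; x₂ = y₂ r ; y₁ = x₁ r ; y₂ = x₂ r ; wide = tall r ; tall = wide r }

  swap-disjoint : ∀ {r s} → InteriorsDisjoint r s → InteriorsDisjoint (swapR r) (swapR s)
  swap-disjoint (inj₁ x₂r≤x₁s) = inj₂ (inj₂ (inj₁ x₂r≤x₁s))
  swap-disjoint (inj₂ (inj₁ x₂s≤x₁r)) = inj₂ (inj₂ (inj₂ x₂s≤x₁r))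
  swap-disjoint (inj₂ (inj₂ (inj₁ y₂r≤y₁s))) = inj₁ y₂r≤y₁s
  swap-disjoint (inj₂ (inj₂ (inj₂ y₂s≤y₁r))) = inj₂ (inj₁ y₂s≤y₁r)

  swap-shares : ∀ {r s} → SharesSegment r s → SharesSegment (swapR r) (swapR s)
  swap-shares (inj₁ vertical-side) = inj₂ vertical-side
  swap-shares (inj₂ horizontal-side) = inj₁ horizontal-side

  -- swapR is an involution up to record eta, so swap-shares also transports back.
  swapL : ∀ {n} → Layout n → Layout n
  swapL L = record
    { R = swapR ∘ R L
    ; disjoint = λ u v u≢v → swap-disjoint {R L u} {R L v} (disjoint L u v u≢v)
    ; adj→seg = λ u v u≢v adj → swap-shares {R L u} {R L v} (adj→seg L u v u≢v adj)
    ; seg→adj = λ u v u≢v shares → seg→adj L u v u≢v (swap-shares {swapR (R L u)} {swapR (R L v)} shares)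
    }

  module _ {n} (L : Layout n) where

    swap-case : HorizontalCase L → VerticalCase (swapL L)
    swap-case (T-beside-B , unflanked) = Sum.swap T-beside-B , swap-sides ∘ unflanked
      where
        swap-sides : ∀ {A B C D : Set} → A × B × C × D → B × A × D × C
        swap-sides (a , b , c , d) = b , a , d , c

    swap-dissection : Dissection (swapL L) → Dissection L
    swap-dissection dissection i j Lb≤i i<Rb bbBottom≤j j<bbTop
      with dissection j i bbBottom≤j j<bbTop Lb≤i i<Rb
    ... | a , y₁≤j , j<y₂ , x₁≤i , i<x₂ = a , x₁≤i , i<x₂ , y₁≤j , j<y₂

    swap-bounds : VerticalBounds (swapL L) → HorizontalBounds L
    swap-bounds (height , width , dissection) =
      width , height , λ height≡ width≡ → swap-dissection (dissection width≡ height≡)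

  vertical : ∀ {n′} (L : Layout (3 ℕ.+ n′)) → VerticalCase L → VerticalBounds L
  vertical L (inj₁ T-above-B , unflanked) =
    TAboveB.bounds L T-above-B (unflanked⇒overlaps {L = L} unflanked)
  vertical L (inj₂ T-below-B , unflanked) = flip-bounds L
    (TAboveB.bounds (flipL L) (ℤ.neg-mono-≤ T-below-B) (unflanked⇒overlaps {L = flipL L} unflanked))

  horizontal : ∀ {n′} (L : Layout (3 ℕ.+ n′)) → HorizontalCase L → HorizontalBounds L
  horizontal L = swap-bounds L ∘ vertical (swapL L) ∘ swap-case L

open Accordion using (vertical; horizontal)

open import Data.Nat using (ℕ; _≤_; s≤s)
open import Data.Integer using (+_) renaming (_≤_ to _≤ℤ_)
open import Data.Product using (_×_; _,_)
open import Relation.Binary.PropositionalEquality using (_≡_)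

lemma13 : (n : ℕ) → 3 ≤ n → (L : Layout n) →
    (VerticalCase L →
       (+ 5 ≤ℤ bbHeight L) × (+ n ≤ℤ bbWidth L)
       × (bbHeight L ≡ + 5 → bbWidth L ≡ + n → Dissection L))
    × (HorizontalCase L →
       (+ n ≤ℤ bbHeight L) × (+ 5 ≤ℤ bbWidth L)
       × (bbHeight L ≡ + n → bbWidth L ≡ + 5 → Dissection L))
lemma13 _ (s≤s (s≤s (s≤s _))) L = vertical L , horizontal L
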